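{- Let $k$ be a fixed positive integer and let $j\in\{1,\ldots,k\}$. For every integer $n$, let $F_n$ be the number of compositions of $n$ all of whose parts lie in $\{1,\ldots,k\}$ (so $F_0=1$, via the empty composition, and $F_n=0$ for $n<0$), and let $C_{n,j}$ be the total number of occurrences of the part $j$ among all such compositions of $n$ (so $C_{n,j}=0$ for $n\le 0$). Then \[ C_{n,j}=\begin{cases}0,& \text{if } n\le 0;\\ F_{n-j}+\sum_{a=1}^k C_{n-a,j}, & \text{if } n>0.\end{cases} \]
   Context: A composition of a nonnegative integer $n$ is a finite sequence of positive integers $(\lambda_1,\ldots,\lambda_m)$ with $\sum_i \lambda_i=n$; the $\lambda_i$ are its parts. The integer $0$ has exactly one composition, the empty one; negative integers have none. -}

module Defs where

open import Data.Nat using (ℕ; zero; suc; _+_; _≟_)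
open import Data.Integer using (ℤ; +_; -[1+_])
open import Data.List using (List; []; _∷_; map; concatMap; filter; length; upTo; _++_)
open import Data.Nat.ListAction using (sum)
open import Relation.Nullary.Decidable using (does)
open import Data.Bool using (Bool)

parts : ℕ → List ℕ
parts k = map suc (upTo k)

listsOfLength : ℕ → ℕ → List (List ℕ)
listsOfLength k zero    = [] ∷ []
listsOfLength k (suc m) = concatMap (λ p → map (p ∷_) (listsOfLength k m)) (parts k)

listsUpTo : ℕ → ℕ → List (List ℕ)
listsUpTo k zero    = listsOfLength k zero
listsUpTo k (suc n) = listsUpTo k n ++ listsOfLength k (suc n)

-- All compositions of the natural number n with all parts in {1,…,k}
-- (a composition of n has at most n parts, each ≥ 1, so filtering lists of
--  length ≤ n by "sum ≡ n" lists each such composition exactly once).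
compositionsℕ : ℕ → ℕ → List (List ℕ)
compositionsℕ k n = filter (λ xs → sum xs ≟ n) (listsUpTo k n)

compositions : ℕ → ℤ → List (List ℕ)
compositions k (+ n)    = compositionsℕ k n
compositions k -[1+ n ] = []

F : ℕ → ℤ → ℕ
F k n = length (compositions k n)

occ : ℕ → List ℕ → ℕ
occ j xs = length (filter (λ x → x ≟ j) xs)

C : ℕ → ℤ → ℕ → ℕ
C k n j = sum (map (occ j) (compositions k n))

sumFrom1 : ℕ → (ℕ → ℕ) → ℕ
sumFrom1 zero    f = 0
sumFrom1 (suc k) f = sumFrom1 k f + f (suc k)

-- Split each composition of n > 0 by its first part a: removing it leaves a composition of
-- n − a, and the first part is an occurrence of j exactly when a = j, which happens once for
-- every composition of n − j.  Compositions are enumerated as lists of length at most n with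
-- entries in {1,…,k} summing to n, so the decomposition is carried out on weighted sums over
-- these lists; since parts are positive, lists longer than their sum never contribute.
module Submission where

open import Defs
open import Data.Nat using (ℕ; _+_; _≤_; _<_)
open import Data.Integer using (ℤ; +_; _-_)
open import Relation.Binary.PropositionalEquality using (_≡_)
open import Data.Product using (_×_)
import Data.Integer

open import Data.Nat using (zero; suc; _*_; z≤n; s≤s; s≤s⁻¹)
open import Data.Nat.Properties
open import Data.Nat.ListAction using (sum)
open import Data.Nat.ListAction.Properties using (sum-++)
open import Data.Integer using (-[1+_]; 0ℤ; _⊖_; +<+; +≤+)
import Data.Integer.Properties as ℤ
open import Data.List using (List; []; _∷_; [_]; map; concatMap; filter; length; upTo; _++_; _∷ʳ_)
open import Data.List.Properties using (map-++; map-cong; map-∘; upTo-∷ʳ; filter-++; length-++; filter-accept; filter-reject)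
open import Data.Bool using (true; false; if_then_else_)
open import Data.Product using (_,_)
open import Function using (_∘_; mk⇔)
open import Relation.Nullary using (yes; no; does)
open import Relation.Nullary.Decidable using (does-⇔; dec-false)
open import Relation.Unary using (Decidable)
open import Relation.Binary.PropositionalEquality
  using (_≢_; ≢-sym; refl; sym; trans; cong; cong₂; subst; module ≡-Reasoning)
open import Algebra.Properties.CommutativeSemigroup +-commutativeSemigroup using (interchange)

private
  variable
    A : Set

sum-map-++ : (h : A → ℕ) (xs ys : List A) → sum (map h (xs ++ ys)) ≡ sum (map h xs) + sum (map h ys)
sum-map-++ h xs ys = trans (cong sum (map-++ h xs ys)) (sum-++ (map h xs) (map h ys))

sum-map-+ : (f g : A → ℕ) (xs : List A) →
  sum (map (λ x → f x + g x) xs) ≡ sum (map f xs) + sum (map g xs)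
sum-map-+ f g []       = refl
sum-map-+ f g (x ∷ xs) = trans (cong (_+_ (f x + g x)) (sum-map-+ f g xs))
                               (interchange (f x) (g x) _ _)

sum-map-const : (c : ℕ) (xs : List A) → sum (map (λ _ → c) xs) ≡ c * length xs
sum-map-const c []       = sym (*-zeroʳ c)
sum-map-const c (x ∷ xs) = trans (cong (_+_ c) (sum-map-const c xs)) (sym (*-suc c (length xs)))

sum-map-zero : {h : A → ℕ} → (∀ x → h x ≡ 0) → (xs : List A) → sum (map h xs) ≡ 0
sum-map-zero h≡0 []       = refl
sum-map-zero h≡0 (x ∷ xs) = cong₂ _+_ (h≡0 x) (sum-map-zero h≡0 xs)

sum-map-concatMap : (h : A → ℕ) (f : ℕ → List A) (ps : List ℕ) →
  sum (map h (concatMap f ps)) ≡ sum (map (λ p → sum (map h (f p))) ps)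
sum-map-concatMap h f []       = refl
sum-map-concatMap h f (p ∷ ps) =
  trans (sum-map-++ h (f p) _) (cong (_+_ (sum (map h (f p)))) (sum-map-concatMap h f ps))

sum-map-filter : {P : A → Set} (P? : Decidable P) (g : A → ℕ) (xs : List A) →
  sum (map g (filter P? xs)) ≡ sum (map (λ x → if does (P? x) then g x else 0) xs)
sum-map-filter P? g []       = refl
sum-map-filter P? g (x ∷ xs) with does (P? x)
... | true  = cong (_+_ (g x)) (sum-map-filter P? g xs)
... | false = sum-map-filter P? g xs

sumFrom1-cong : ∀ k {f g : ℕ → ℕ} → (∀ a → f (suc a) ≡ g (suc a)) → sumFrom1 k f ≡ sumFrom1 k g
sumFrom1-cong zero    f≡g = refl
sumFrom1-cong (suc k) f≡g = cong₂ _+_ (sumFrom1-cong k f≡g) (f≡g k)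

sumFrom1-zero : ∀ k {f : ℕ → ℕ} → (∀ a → suc a ≤ k → f (suc a) ≡ 0) → sumFrom1 k f ≡ 0
sumFrom1-zero zero    f≡0 = refl
sumFrom1-zero (suc k) f≡0 =
  cong₂ _+_ (sumFrom1-zero k (λ a a<k → f≡0 a (m≤n⇒m≤1+n a<k))) (f≡0 k ≤-refl)

sumFrom1-+ : ∀ k (f g : ℕ → ℕ) →
  sumFrom1 k (λ a → f a + g a) ≡ sumFrom1 k f + sumFrom1 k g
sumFrom1-+ zero    f g = refl
sumFrom1-+ (suc k) f g = trans (cong (_+ (f (suc k) + g (suc k))) (sumFrom1-+ k f g))
                               (interchange (sumFrom1 k f) (sumFrom1 k g) _ _)

sum-map-parts : ∀ k (f : ℕ → ℕ) → sum (map f (parts k)) ≡ sumFrom1 k f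
sum-map-parts zero    f = refl
sum-map-parts (suc k) f = begin
  sum (map f (parts (suc k)))                  ≡⟨ cong (sum ∘ map f ∘ map suc) (upTo-∷ʳ k) ⟨
  sum (map f (map suc (upTo k ∷ʳ k)))          ≡⟨ cong (sum ∘ map f) (map-++ suc (upTo k) [ k ]) ⟩
  sum (map f (parts k ++ [ suc k ]))           ≡⟨ sum-map-++ f (parts k) [ suc k ] ⟩
  sum (map f (parts k)) + (f (suc k) + 0)      ≡⟨ cong₂ _+_ (sum-map-parts k f) (+-identityʳ (f (suc k))) ⟩
  sumFrom1 k f + f (suc k)                     ∎
  where open ≡-Reasoning

occ-∷ : ∀ j a xs → occ j (a ∷ xs) ≡ occ j [ a ] + occ j xs
occ-∷ j a xs = trans (cong length (filter-++ (_≟ j) [ a ] xs)) (length-++ (filter (_≟ j) [ a ]))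

occ-[j] : ∀ j → occ j [ j ] ≡ 1
occ-[j] j = cong length (filter-accept (_≟ j) refl)

occ-[≢] : ∀ {j a} → a ≢ j → occ j [ a ] ≡ 0
occ-[≢] {j} a≢j = cong length (filter-reject (_≟ j) a≢j)

sumFrom1-select : ∀ k j (X : ℕ → ℕ) → 1 ≤ j → j ≤ k → sumFrom1 k (λ a → occ j [ a ] * X a) ≡ X j
sumFrom1-select zero    (suc j) X 1≤j ()
sumFrom1-select (suc k) j       X 1≤j j≤1+k with suc k ≟ j
... | yes refl =
  cong₂ _+_ (sumFrom1-zero k (λ a a<k → cong (_* X (suc a)) (occ-[≢] (λ eq → <-irrefl eq (s≤s a<k)))))
            (trans (cong (_* X (suc k)) (occ-[j] (suc k))) (*-identityˡ (X (suc k))))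
... | no 1+k≢j = trans (cong₂ _+_ (sumFrom1-select k j X 1≤j (s≤s⁻¹ (≤∧≢⇒< j≤1+k (≢-sym 1+k≢j))))
                                  (cong (_* X (suc k)) (occ-[≢] 1+k≢j)))
                       (+-identityʳ (X j))

restrictSum : ℕ → (List ℕ → ℕ) → List ℕ → ℕ
restrictSum n g xs = if does (sum xs ≟ n) then g xs else 0

restrictSum-∷ : ∀ a m (g : List ℕ → ℕ) xs → restrictSum (a + m) g (a ∷ xs) ≡ restrictSum m (g ∘ (a ∷_)) xs
restrictSum-∷ a m g xs = cong (λ b → if b then g (a ∷ xs) else 0)
  (does-⇔ (mk⇔ (+-cancelˡ-≡ a _ _) (cong (_+_ a))) (a + sum xs ≟ a + m) (sum xs ≟ m))

restrictSum-< : ∀ {n} (g : List ℕ → ℕ) xs → n < sum xs → restrictSum n g xs ≡ 0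
restrictSum-< g xs n<sum = cong (λ b → if b then g xs else 0)
  (dec-false (sum xs ≟ _) (λ sum≡n → <-irrefl (sym sum≡n) n<sum))

module _ (k : ℕ) where

  sum-listsOfLength-suc : ∀ m (h : List ℕ → ℕ) →
    sum (map h (listsOfLength k (suc m))) ≡ sumFrom1 k (λ a → sum (map (h ∘ (a ∷_)) (listsOfLength k m)))
  sum-listsOfLength-suc m h = begin
    sum (map h (concatMap (λ a → map (a ∷_) L) (parts k)))  ≡⟨ sum-map-concatMap h (λ a → map (a ∷_) L) (parts k) ⟩
    sum (map (λ a → sum (map h (map (a ∷_) L))) (parts k))  ≡⟨ cong sum (map-cong (λ a → cong sum (map-∘ L)) (parts k)) ⟨
    sum (map (λ a → sum (map (h ∘ (a ∷_)) L)) (parts k))    ≡⟨ sum-map-parts k _ ⟩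
    sumFrom1 k (λ a → sum (map (h ∘ (a ∷_)) L))             ∎
    where
    open ≡-Reasoning
    L : List (List ℕ)
    L = listsOfLength k m

  sum-listsUpTo-suc : ∀ n (h : List ℕ → ℕ) →
    sum (map h (listsUpTo k (suc n))) ≡ h [] + sumFrom1 k (λ a → sum (map (h ∘ (a ∷_)) (listsUpTo k n)))
  sum-listsUpTo-suc zero    h = cong (_+_ (h [])) (sum-listsOfLength-suc zero h)
  sum-listsUpTo-suc (suc n) h = begin
    sum (map h (listsUpTo k (suc n) ++ listsOfLength k (suc (suc n))))
      ≡⟨ sum-map-++ h (listsUpTo k (suc n)) _ ⟩
    sum (map h (listsUpTo k (suc n))) + sum (map h (listsOfLength k (suc (suc n))))
      ≡⟨ cong₂ _+_ (sum-listsUpTo-suc n h) (sum-listsOfLength-suc (suc n) h) ⟩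
    (h [] + sumFrom1 k (λ a → sum (map (h ∘ (a ∷_)) (listsUpTo k n))))
      + sumFrom1 k (λ a → sum (map (h ∘ (a ∷_)) (listsOfLength k (suc n))))
      ≡⟨ +-assoc (h []) _ _ ⟩
    h [] + (sumFrom1 k (λ a → sum (map (h ∘ (a ∷_)) (listsUpTo k n)))
            + sumFrom1 k (λ a → sum (map (h ∘ (a ∷_)) (listsOfLength k (suc n)))))
      ≡⟨ cong (_+_ (h [])) (sumFrom1-+ k _ _) ⟨
    h [] + sumFrom1 k (λ a → sum (map (h ∘ (a ∷_)) (listsUpTo k n))
                             + sum (map (h ∘ (a ∷_)) (listsOfLength k (suc n))))
      ≡⟨ cong (_+_ (h [])) (sumFrom1-cong k (λ a → sum-map-++ (h ∘ (suc a ∷_)) (listsUpTo k n) _)) ⟨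
    h [] + sumFrom1 k (λ a → sum (map (h ∘ (a ∷_)) (listsUpTo k (suc n))))
      ∎
    where open ≡-Reasoning

  -- Every list of length m with positive entries has sum at least m.
  sum-listsOfLength-vanishing : ∀ m (h : List ℕ → ℕ) → (∀ xs → m ≤ sum xs → h xs ≡ 0) →
    sum (map h (listsOfLength k m)) ≡ 0
  sum-listsOfLength-vanishing zero    h h≡0 = trans (+-identityʳ (h [])) (h≡0 [] z≤n)
  sum-listsOfLength-vanishing (suc m) h h≡0 =
    trans (sum-listsOfLength-suc m h)
          (sumFrom1-zero k (λ a _ → sum-listsOfLength-vanishing m (h ∘ (suc a ∷_))
             (λ xs m≤sum → h≡0 (suc a ∷ xs) (s≤s (≤-trans m≤sum (m≤n+m (sum xs) a))))))

  sum-restrictSum-listsUpTo-+ : ∀ d n (g : List ℕ → ℕ) →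
    sum (map (restrictSum n g) (listsUpTo k (d + n))) ≡ sum (map (restrictSum n g) (listsUpTo k n))
  sum-restrictSum-listsUpTo-+ zero    n g = refl
  sum-restrictSum-listsUpTo-+ (suc d) n g =
    trans (sum-map-++ (restrictSum n g) (listsUpTo k (d + n)) _)
          (trans (cong₂ _+_ (sum-restrictSum-listsUpTo-+ d n g)
                            (sum-listsOfLength-vanishing (suc (d + n)) (restrictSum n g)
                               (λ xs long → restrictSum-< g xs (≤-trans (s≤s (m≤n+m n d)) long))))
                 (+-identityʳ _))

  sumOverCompositions : ℤ → (List ℕ → ℕ) → ℕ
  sumOverCompositions z g = sum (map g (compositions k z))

  sumOverCompositions-nonneg : ∀ n (g : List ℕ → ℕ) →
    sumOverCompositions (+ n) g ≡ sum (map (restrictSum n g) (listsUpTo k n))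
  sumOverCompositions-nonneg n g = sum-map-filter (λ xs → sum xs ≟ n) g (listsUpTo k n)

  sumOverCompositions-negative : ∀ {z} (g : List ℕ → ℕ) → z Data.Integer.< 0ℤ → sumOverCompositions z g ≡ 0
  sumOverCompositions-negative {+ _}       g (+<+ ())
  sumOverCompositions-negative { -[1+ _ ]} g _ = refl

  sumOverCompositions-const : ∀ z c → sumOverCompositions z (λ _ → c) ≡ c * F k z
  sumOverCompositions-const z c = sum-map-const c (compositions k z)

  sumOverCompositions-+ : ∀ z (f g : List ℕ → ℕ) →
    sumOverCompositions z (λ xs → f xs + g xs) ≡ sumOverCompositions z f + sumOverCompositions z g
  sumOverCompositions-+ z f g = sum-map-+ f g (compositions k z)

  sum-restrictSum-firstPart : ∀ n a (g : List ℕ → ℕ) →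
    sum (map (λ xs → restrictSum (suc n) g (suc a ∷ xs)) (listsUpTo k n))
      ≡ sumOverCompositions (+ suc n - + suc a) (g ∘ (suc a ∷_))
  sum-restrictSum-firstPart n a g with a ≤? n
  ... | yes a≤n with m , refl ← m≤n⇒∃[o]m+o≡n a≤n = begin
    sum (map (λ xs → restrictSum (suc a + m) g (suc a ∷ xs)) (listsUpTo k (a + m)))
      ≡⟨ cong sum (map-cong (restrictSum-∷ (suc a) m g) (listsUpTo k (a + m))) ⟩
    sum (map (restrictSum m (g ∘ (suc a ∷_))) (listsUpTo k (a + m)))
      ≡⟨ sum-restrictSum-listsUpTo-+ a m (g ∘ (suc a ∷_)) ⟩
    sum (map (restrictSum m (g ∘ (suc a ∷_))) (listsUpTo k m))
      ≡⟨ sumOverCompositions-nonneg m (g ∘ (suc a ∷_)) ⟨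
    sumOverCompositions (+ m) (g ∘ (suc a ∷_))
      ≡⟨ cong (λ z → sumOverCompositions z (g ∘ (suc a ∷_))) difference ⟨
    sumOverCompositions (+ suc (a + m) - + suc a) (g ∘ (suc a ∷_))
      ∎
    where
    open ≡-Reasoning
    difference : + suc (a + m) - + suc a ≡ + m
    difference = trans (ℤ.⊖-≥ (s≤s (m≤m+n a m))) (cong +_ (m+n∸m≡n a m))
  ... | no a≰n =
    trans (sum-map-zero (λ xs → restrictSum-< g (suc a ∷ xs) (s≤s (≤-trans n<a (m≤m+n a (sum xs)))))
                        (listsUpTo k n))
          (sym (sumOverCompositions-negative (g ∘ (suc a ∷_)) difference<0))
    where
    n<a : n < a
    n<a = ≰⇒> a≰n
    difference<0 : + suc n - + suc a Data.Integer.< 0ℤ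
    difference<0 = subst (suc n ⊖ suc a Data.Integer.<_) (ℤ.n⊖n≡0 (suc n)) (ℤ.⊖-monoʳ->-< (suc n) (s≤s n<a))

  sumOverCompositions-suc : ∀ n (h : List ℕ → ℕ) →
    sumOverCompositions (+ suc n) h ≡ sumFrom1 k (λ a → sumOverCompositions (+ suc n - + a) (h ∘ (a ∷_)))
  sumOverCompositions-suc n h = begin
    sumOverCompositions (+ suc n) h
      ≡⟨ sumOverCompositions-nonneg (suc n) h ⟩
    sum (map (restrictSum (suc n) h) (listsUpTo k (suc n)))
      ≡⟨ sum-listsUpTo-suc n (restrictSum (suc n) h) ⟩
    restrictSum (suc n) h [] + sumFrom1 k (λ a → sum (map (restrictSum (suc n) h ∘ (a ∷_)) (listsUpTo k n)))
      ≡⟨ sumFrom1-cong k (λ a → sum-restrictSum-firstPart n a h) ⟩ -- the empty list's term reduces to 0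
    sumFrom1 k (λ a → sumOverCompositions (+ suc n - + a) (h ∘ (a ∷_)))
      ∎
    where open ≡-Reasoning

  sumOverCompositions-occ-∷ : ∀ z j a →
    sumOverCompositions z (occ j ∘ (a ∷_)) ≡ occ j [ a ] * F k z + C k z j
  sumOverCompositions-occ-∷ z j a =
    trans (cong sum (map-cong (occ-∷ j a) (compositions k z)))
          (trans (sumOverCompositions-+ z (λ _ → occ j [ a ]) (occ j))
                 (cong (_+ C k z j) (sumOverCompositions-const z (occ j [ a ]))))

theorem2p2 : (k j : ℕ) → 1 ≤ k → 1 ≤ j → j ≤ k → (n : ℤ) →
    (n Data.Integer.≤ + 0 → C k n j ≡ 0) ×
    (+ 0 Data.Integer.< n →
      C k n j ≡ F k (n - + j) + sumFrom1 k (λ a → C k (n - + a) j))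
theorem2p2 k j _ 1≤j j≤k n = nonpositive n , positive n
  where
  nonpositive : ∀ n → n Data.Integer.≤ + 0 → C k n j ≡ 0
  nonpositive (+ zero)    _          = refl
  nonpositive (+ suc _)   (+≤+ ())
  nonpositive -[1+ _ ]    _          = refl

  positive : ∀ n → + 0 Data.Integer.< n → C k n j ≡ F k (n - + j) + sumFrom1 k (λ a → C k (n - + a) j)
  positive (+ zero)  (+<+ ())
  positive (+ suc n) _ = begin
    C k (+ suc n) j
      ≡⟨ sumOverCompositions-suc k n (occ j) ⟩
    sumFrom1 k (λ a → sumOverCompositions k (+ suc n - + a) (occ j ∘ (a ∷_)))
      ≡⟨ sumFrom1-cong k (λ a → sumOverCompositions-occ-∷ k (+ suc n - + suc a) j (suc a)) ⟩
    sumFrom1 k (λ a → occ j [ a ] * F k (+ suc n - + a) + C k (+ suc n - + a) j)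
      ≡⟨ sumFrom1-+ k _ _ ⟩
    sumFrom1 k (λ a → occ j [ a ] * F k (+ suc n - + a)) + sumFrom1 k (λ a → C k (+ suc n - + a) j)
      ≡⟨ cong (_+ sumFrom1 k (λ a → C k (+ suc n - + a) j)) (sumFrom1-select k j _ 1≤j j≤k) ⟩
    F k (+ suc n - + j) + sumFrom1 k (λ a → C k (+ suc n - + a) j)
      ∎
    where open ≡-Reasoning
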